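{- For every integer $m\geq1$ there exists a dataset $X\subset\mathbb{R}$ of $n\geq m$ points such that for every $0<\epsilon<0.5$, every $\epsilon$-coreset of $X$ for $(1,m)$-Robust Median has size $\Omega(m)$, i.e. $|S|\geq c\,m$ for an absolute constant $c>0$.
   Context: Distances are Euclidean (here on $\mathbb{R}$). A weighted set is a finite set $S$ with weights $w_S:S\to\mathbb{R}_{\geq0}$; unweighted sets have unit weights. For a weighted set $(X,w_X)$, $\mathcal{L}^{(m)}_X$ is the collection of weighted sets $(Y,w_Y)$ with $Y\subseteq X$, $w_Y\leq w_X$ pointwise and total weight $m$, and $X-Y$ has weights $w_X-w_Y$. For a center $c$, $\mathrm{cost}^{(m)}_1(X,c)=\min_{(L,w_L)\in\mathcal{L}^{(m)}_X}\sum_{x}(w_X(x)-w_L(x))\,|x-c|$. $(1,m)$-Robust Median is the problem of choosing one center $c$ to minimize $\mathrm{cost}^{(m)}_1(X,c)$. An $\epsilon$-coreset of $X$ for $(1,m)$-Robust Median is a weighted subset $(S,w_S)$ of $X$ such that for every $c\in\mathbb{R}$, $\mathrm{cost}^{(m)}_1(S,c)\in(1\pm\epsilon)\mathrm{cost}^{(m)}_1(X,c)$; its size is $|S|$.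
   Formalization: The parameter ε and the coreset weights $w_S$ are rational rather than in $\mathbb{R}_{\geq0}$, as are the weights in $\mathcal{L}^{(m)}_X$; the points of $X$ and the centers $c$ are also taken among the rationals. -}

module Defs where

open import Data.Nat as ℕ using (ℕ; zero; suc)
open import Data.Integer using (+_)
open import Data.Fin using (Fin; zero; suc)
open import Data.Fin.Subset using (Subset; _∉_)
open import Data.Rational using (ℚ; 0ℚ; 1ℚ; _+_; _-_; _*_; _≤_; ∣_∣; _/_)
open import Data.Product using (Σ; _×_)
open import Relation.Binary.PropositionalEquality using (_≡_)

ℕ→ℚ : ℕ → ℚ
ℕ→ℚ k = + k / 1

Σᶠ : ∀ {n} → (Fin n → ℚ) → ℚ
Σᶠ {zero}  f = 0ℚ
Σᶠ {suc n} f = f zero + Σᶠ (λ i → f (suc i))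

-- A weighted set is given by points p : Fin n → ℚ and weights w : Fin n → ℚ.
-- (L, wL) ∈ 𝓛^(m)_X : weights 0 ≤ wL ≤ w pointwise, total weight m.
InL : ∀ {n} → ℕ → (w wL : Fin n → ℚ) → Set
InL m w wL = (∀ i → (0ℚ ≤ wL i) × (wL i ≤ w i)) × (Σᶠ wL ≡ ℕ→ℚ m)

removalCost : ∀ {n} → (p w wL : Fin n → ℚ) → ℚ → ℚ
removalCost p w wL c = Σᶠ (λ i → (w i - wL i) * ∣ p i - c ∣)

IsCost : ∀ {n} → ℕ → (p w : Fin n → ℚ) → ℚ → ℚ → Set
IsCost m p w c v =
  Σ _ (λ wL → InL m w wL × (removalCost p w wL c ≡ v))
  × (∀ wL → InL m w wL → v ≤ removalCost p w wL c)

unit : ∀ {n} → Fin n → ℚ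
unit _ = 1ℚ

-- (S, wS) with S ⊆ X (given as a Subset of the indices of X) is an
-- ε-coreset of the unweighted set X = {p i} for (1,m)-Robust Median.
IsCoreset : ∀ {n} → ℕ → (p : Fin n → ℚ) → ℚ → Subset n → (Fin n → ℚ) → Set
IsCoreset m p ε S wS =
  (∀ i → 0ℚ ≤ wS i) × (∀ i → i ∉ S → wS i ≡ 0ℚ) ×
  (∀ c → Σ ℚ (λ vX → Σ ℚ (λ vS →
      IsCost m p unit c vX × IsCost m p wS c vS
      × ((1ℚ - ε) * vX ≤ vS) × (vS ≤ (1ℚ + ε) * vX))))

{-# OPTIONS --safe #-}

-- Take X = {0, 1, …, m}.  Centred at a point i of X the robust cost of X is 0 (discard the
-- other m points), so an ε-coreset costs 0 there as well: its discarded weight covers all of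
-- its weight away from i.  If i ∉ S the coreset has no weight at i, so its total weight is
-- exactly m.  Centred at −1 such a coreset discards everything and costs 0, whereas X keeps
-- one point at distance ≥ 1 and costs ≥ 1, contradicting (1 − ε) · 1 > 0.  Hence S = X.

module Submission where

open import Defs
open import Data.Nat using (ℕ; _≥_)
open import Data.Fin using (Fin)
open import Data.Fin.Subset using (Subset; ∣_∣)
open import Data.Rational using (ℚ; 0ℚ; ½; _<_; _≤_; _*_)
open import Data.Product using (Σ; _×_)
open import Function.Definitions using (Injective)
open import Relation.Binary.PropositionalEquality using (_≡_)

open import Data.Empty using (⊥; ⊥-elim)
open import Data.Fin using (zero; suc; toℕ; _≟_)
open import Data.Fin.Properties using (toℕ-injective)
open import Data.Fin.Subset using (_∈_; ⊤)
open import Data.Fin.Subset.Properties using (_∈?_; ⊆-antisym; ⊆⊤; ∣⊤∣≡n)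
import Data.Integer as ℤ using (+_; _+_; 1ℤ)
import Data.Integer.Properties as ℤ using (*-identityʳ; +-injective)
open import Data.Nat using (zero; suc)
import Data.Nat.Coprimality as Coprimality
open import Data.Nat.Properties using (n≤1+n)
open import Data.Product using (_,_; proj₁; proj₂)
import Data.Rational as Q
open Q using (1ℚ; _+_; _-_; -_; mkℚ; ↥_; nonNegative; ≢-nonZero; 1/_)
open import Data.Rational.Properties
  using ( _≤?_; _<?_; ≤-refl; ≤-reflexive; ≤-trans; ≤-antisym; <-trans; ≤-<-trans; <⇒≤; <-irrefl
        ; module ≤-Reasoning; normalize-coprime; nonNegative⁻¹; nonNeg*nonNeg⇒nonNeg; +-0-group
        ; +-identityˡ; +-identityʳ; +-inverseʳ; +-mono-≤; +-monoˡ-≤; +-monoʳ-≤; +-monoˡ-<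
        ; *-identityˡ; *-identityʳ; *-inverseʳ; *-assoc; *-zeroˡ; *-zeroʳ; *-monoˡ-≤-nonNeg
        ; ∣p∣≡0⇒p≡0; 0≤∣p∣; 0≤p⇒∣p∣≡p )
open import Data.Rational.Solver using (module +-*-Solver)
open import Algebra.Properties.Group +-0-group using (x∙y⁻¹≈ε⇒x≈y)
open import Function using (_∘_)
open import Relation.Nullary using (yes; no)
open import Relation.Nullary.Decidable using (from-yes)
open import Relation.Binary.PropositionalEquality
  using (refl; sym; trans; cong; cong₂; _≢_; module ≡-Reasoning)

ℕ→ℚ≡mkℚ : ∀ k → ℕ→ℚ k ≡ mkℚ (ℤ.+ k) 0 (Coprimality.sym (Coprimality.1-coprimeTo k))
ℕ→ℚ≡mkℚ k = normalize-coprime (Coprimality.sym (Coprimality.1-coprimeTo k))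

ℕ→ℚ-suc : ∀ k → ℕ→ℚ (suc k) ≡ 1ℚ + ℕ→ℚ k
-- Once ℕ→ℚ k is in normal form, the sum on the right computes to (1 + k * 1) / 1.
ℕ→ℚ-suc k rewrite ℕ→ℚ≡mkℚ k = cong (Q._/ 1) (cong (λ i → ℤ.1ℤ ℤ.+ i) (sym (ℤ.*-identityʳ (ℤ.+ k))))

ℕ→ℚ-injective : Injective _≡_ _≡_ ℕ→ℚ
ℕ→ℚ-injective {a} {b} eq = ℤ.+-injective (cong ↥_ (begin
  mkℚ (ℤ.+ a) 0 _  ≡⟨ sym (ℕ→ℚ≡mkℚ a) ⟩
  ℕ→ℚ a            ≡⟨ eq ⟩
  ℕ→ℚ b            ≡⟨ ℕ→ℚ≡mkℚ b ⟩
  mkℚ (ℤ.+ b) 0 _  ∎))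
  where open ≡-Reasoning

0≤ℕ→ℚ : ∀ k → 0ℚ ≤ ℕ→ℚ k
0≤ℕ→ℚ k rewrite ℕ→ℚ≡mkℚ k = nonNegative⁻¹ _

0≤1 : 0ℚ ≤ 1ℚ
0≤1 = from-yes (0ℚ ≤? 1ℚ)

p≤q⇒0≤q-p : ∀ {p q} → p ≤ q → 0ℚ ≤ q - p
p≤q⇒0≤q-p {p} {q} p≤q = ≤-trans (≤-reflexive (sym (+-inverseʳ p))) (+-monoˡ-≤ (- p) p≤q)

p<q⇒0<q-p : ∀ {p q} → p < q → 0ℚ < q - p
p<q⇒0<q-p {p} {q} p<q = ≤-<-trans (≤-reflexive (sym (+-inverseʳ p))) (+-monoˡ-< (- p) p<q)

0≤q⇒p≤p+q : ∀ {p q} → 0ℚ ≤ q → p ≤ p + q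
0≤q⇒p≤p+q {p} {q} 0≤q = ≤-trans (≤-reflexive (sym (+-identityʳ p))) (+-monoʳ-≤ p 0≤q)

0≤p⇒q≤p+q : ∀ {p q} → 0ℚ ≤ p → q ≤ p + q
0≤p⇒q≤p+q {p} {q} 0≤p = ≤-trans (≤-reflexive (sym (+-identityˡ q))) (+-monoˡ-≤ q 0≤p)

0≤p⇒0≤q⇒0≤p*q : ∀ {p q} → 0ℚ ≤ p → 0ℚ ≤ q → 0ℚ ≤ p * q
0≤p⇒0≤q⇒0≤p*q {p} {q} 0≤p 0≤q =
  nonNegative⁻¹ _ {{nonNeg*nonNeg⇒nonNeg p {{nonNegative 0≤p}} q {{nonNegative 0≤q}}}}

p-q≡0⇒p≡q : ∀ {p q} → p - q ≡ 0ℚ → p ≡ q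
p-q≡0⇒p≡q {p} {q} = x∙y⁻¹≈ε⇒x≈y p q

p*q≡0⇒q≢0⇒p≡0 : ∀ p q → p * q ≡ 0ℚ → q ≢ 0ℚ → p ≡ 0ℚ
p*q≡0⇒q≢0⇒p≡0 p q pq≡0 q≢0 = begin
  p                ≡⟨ sym (*-identityʳ p) ⟩
  p * 1ℚ           ≡⟨ cong (p *_) (sym (*-inverseʳ q)) ⟩
  p * (q * 1/ q)   ≡⟨ sym (*-assoc p q (1/ q)) ⟩
  (p * q) * 1/ q   ≡⟨ cong (_* 1/ q) pq≡0 ⟩
  0ℚ * 1/ q        ≡⟨ *-zeroˡ (1/ q) ⟩
  0ℚ               ∎
  where
  open ≡-Reasoning
  instance q≢0′ = ≢-nonZero q≢0

Σᶠ-cong : ∀ {n} {f g : Fin n → ℚ} → (∀ i → f i ≡ g i) → Σᶠ f ≡ Σᶠ g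
Σᶠ-cong {zero}  f≡g = refl
Σᶠ-cong {suc n} f≡g = cong₂ _+_ (f≡g zero) (Σᶠ-cong (λ i → f≡g (suc i)))

Σᶠ-0 : ∀ {n} → Σᶠ {n} (λ _ → 0ℚ) ≡ 0ℚ
Σᶠ-0 {zero}  = refl
Σᶠ-0 {suc n} = cong (0ℚ +_) (Σᶠ-0 {n})

Σᶠ-1 : ∀ n → Σᶠ {n} unit ≡ ℕ→ℚ n
Σᶠ-1 zero    = refl
Σᶠ-1 (suc n) = trans (cong (1ℚ +_) (Σᶠ-1 n)) (sym (ℕ→ℚ-suc n))

Σᶠ-sub : ∀ {n} (f g : Fin n → ℚ) → Σᶠ (λ i → f i - g i) ≡ Σᶠ f - Σᶠ g
Σᶠ-sub {zero}  f g = refl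
Σᶠ-sub {suc n} f g = begin
  (f zero - g zero) + Σᶠ (λ i → f (suc i) - g (suc i))  ≡⟨ cong ((f zero - g zero) +_) (Σᶠ-sub (f ∘ suc) (g ∘ suc)) ⟩
  (f zero - g zero) + (Σᶠ (f ∘ suc) - Σᶠ (g ∘ suc))     ≡⟨ swap (f zero) (g zero) (Σᶠ (f ∘ suc)) (Σᶠ (g ∘ suc)) ⟩
  (f zero + Σᶠ (f ∘ suc)) - (g zero + Σᶠ (g ∘ suc))     ∎
  where
  open ≡-Reasoning
  open +-*-Solver
  swap : ∀ a b x y → (a - b) + (x - y) ≡ (a + x) - (b + y)
  swap = solve 4 (λ a b x y → (a :- b) :+ (x :- y) := (a :+ x) :- (b :+ y)) refl

Σᶠ-mono : ∀ {n} {f g : Fin n → ℚ} → (∀ i → f i ≤ g i) → Σᶠ f ≤ Σᶠ g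
Σᶠ-mono {zero}  f≤g = ≤-refl
Σᶠ-mono {suc n} f≤g = +-mono-≤ (f≤g zero) (Σᶠ-mono (λ i → f≤g (suc i)))

Σᶠ-nonNeg : ∀ {n} {f : Fin n → ℚ} → (∀ i → 0ℚ ≤ f i) → 0ℚ ≤ Σᶠ f
Σᶠ-nonNeg {n} 0≤f = ≤-trans (≤-reflexive (sym (Σᶠ-0 {n}))) (Σᶠ-mono 0≤f)

Σᶠ-nonNeg-≤0⇒≡0 : ∀ {n} {f : Fin n → ℚ} → (∀ i → 0ℚ ≤ f i) → Σᶠ f ≤ 0ℚ → ∀ i → f i ≡ 0ℚ
Σᶠ-nonNeg-≤0⇒≡0 {suc n} 0≤f Σf≤0 zero =
  ≤-antisym (≤-trans (0≤q⇒p≤p+q (Σᶠ-nonNeg (λ i → 0≤f (suc i)))) Σf≤0) (0≤f zero)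
Σᶠ-nonNeg-≤0⇒≡0 {suc n} 0≤f Σf≤0 (suc i) =
  Σᶠ-nonNeg-≤0⇒≡0 (λ i → 0≤f (suc i)) (≤-trans (0≤p⇒q≤p+q (0≤f zero)) Σf≤0) i

𝟙 : ∀ {n} → Fin n → Fin n → ℚ
𝟙 zero    zero    = 1ℚ
𝟙 zero    (suc _) = 0ℚ
𝟙 (suc _) zero    = 0ℚ
𝟙 (suc i) (suc j) = 𝟙 i j

Σᶠ-𝟙 : ∀ {n} (i : Fin n) → Σᶠ (𝟙 i) ≡ 1ℚ
Σᶠ-𝟙 {suc n} zero    = cong (1ℚ +_) (Σᶠ-0 {n})
Σᶠ-𝟙 {suc n} (suc i) = cong (0ℚ +_) (Σᶠ-𝟙 i)

𝟙-off : ∀ {n} {i j : Fin n} → i ≢ j → 𝟙 i j ≡ 0ℚ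
𝟙-off {i = zero}  {zero}  i≢j = ⊥-elim (i≢j refl)
𝟙-off {i = zero}  {suc j} i≢j = refl
𝟙-off {i = suc i} {zero}  i≢j = refl
𝟙-off {i = suc i} {suc j} i≢j = 𝟙-off (i≢j ∘ cong suc)

discardAllBut : ∀ {n} → Fin n → Fin n → ℚ
discardAllBut i j = 1ℚ - 𝟙 i j

discardAllBut-bounds : ∀ {n} (i j : Fin n) → (0ℚ ≤ discardAllBut i j) × (discardAllBut i j ≤ 1ℚ)
discardAllBut-bounds zero    zero    = ≤-refl , 0≤1
discardAllBut-bounds zero    (suc _) = 0≤1 , ≤-refl
discardAllBut-bounds (suc _) zero    = 0≤1 , ≤-refl
discardAllBut-bounds (suc i) (suc j) = discardAllBut-bounds i j

discardAllBut∈𝓛 : ∀ {m} (i : Fin (suc m)) → InL m unit (discardAllBut i)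
discardAllBut∈𝓛 {m} i = discardAllBut-bounds i , (begin
  Σᶠ (λ j → 1ℚ - 𝟙 i j)       ≡⟨ Σᶠ-sub {suc m} unit (𝟙 i) ⟩
  Σᶠ {suc m} unit - Σᶠ (𝟙 i)   ≡⟨ cong₂ _-_ (Σᶠ-1 (suc m)) (Σᶠ-𝟙 i) ⟩
  ℕ→ℚ (suc m) - 1ℚ             ≡⟨ cong (_- 1ℚ) (ℕ→ℚ-suc m) ⟩
  (1ℚ + ℕ→ℚ m) - 1ℚ            ≡⟨ solve 1 (λ x → (con 1ℚ :+ x) :- con 1ℚ := x) refl (ℕ→ℚ m) ⟩
  ℕ→ℚ m                        ∎)
  where
  open ≡-Reasoning
  open +-*-Solver

removalCost-discardAllBut : ∀ {n} (p : Fin n → ℚ) i → removalCost p unit (discardAllBut i) (p i) ≡ 0ℚ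
removalCost-discardAllBut {n} p i = trans (Σᶠ-cong term≡0) (Σᶠ-0 {n})
  where
  term≡0 : ∀ j → (1ℚ - discardAllBut i j) * Q.∣ p j - p i ∣ ≡ 0ℚ
  term≡0 j with i ≟ j
  ... | yes refl = trans (cong (λ d → kept * Q.∣ d ∣) (+-inverseʳ (p i))) (*-zeroʳ kept)
    where kept = 1ℚ - discardAllBut i i
  ... | no i≢j rewrite 𝟙-off i≢j = *-zeroˡ Q.∣ p j - p i ∣

module _ {n m} {w wL : Fin n → ℚ} (wL∈𝓛 : InL m w wL) where

  residual-nonNeg : ∀ j → 0ℚ ≤ w j - wL j
  residual-nonNeg j = p≤q⇒0≤q-p (proj₂ (proj₁ wL∈𝓛 j))

  Σᶠ-residual : Σᶠ (λ j → w j - wL j) ≡ Σᶠ w - ℕ→ℚ m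
  Σᶠ-residual = trans (Σᶠ-sub w wL) (cong (λ x → Σᶠ w - x) (proj₂ wL∈𝓛))

  removalCost-≥-excess : ∀ {p c} → (∀ j → 1ℚ ≤ Q.∣ p j - c ∣) → Σᶠ w - ℕ→ℚ m ≤ removalCost p w wL c
  removalCost-≥-excess {p} {c} 1≤dist = begin
    Σᶠ w - ℕ→ℚ m                              ≡⟨ sym Σᶠ-residual ⟩
    Σᶠ (λ j → w j - wL j)                     ≤⟨ Σᶠ-mono residual≤term ⟩
    Σᶠ (λ j → (w j - wL j) * Q.∣ p j - c ∣)   ∎
    where
    open ≤-Reasoning
    residual≤term : ∀ j → w j - wL j ≤ (w j - wL j) * Q.∣ p j - c ∣
    residual≤term j = ≤-trans (≤-reflexive (sym (*-identityʳ (w j - wL j))))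
      (*-monoˡ-≤-nonNeg (w j - wL j) {{nonNegative (residual-nonNeg j)}} (1≤dist j))

  removalCost-noExcess : ∀ {p c} → Σᶠ w ≡ ℕ→ℚ m → removalCost p w wL c ≡ 0ℚ
  removalCost-noExcess {p} {c} Σw≡m = trans (Σᶠ-cong term≡0) (Σᶠ-0 {n})
    where
    residual≡0 : ∀ j → w j - wL j ≡ 0ℚ
    residual≡0 = Σᶠ-nonNeg-≤0⇒≡0 residual-nonNeg
      (≤-reflexive (trans Σᶠ-residual (trans (cong (_- ℕ→ℚ m) Σw≡m) (+-inverseʳ (ℕ→ℚ m)))))
    term≡0 : ∀ j → (w j - wL j) * Q.∣ p j - c ∣ ≡ 0ℚ
    term≡0 j = trans (cong (_* Q.∣ p j - c ∣) (residual≡0 j)) (*-zeroˡ Q.∣ p j - c ∣)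

  removalCost≤0⇒w≡wL : ∀ {p c} → removalCost p w wL c ≤ 0ℚ → ∀ j → p j ≢ c → w j ≡ wL j
  removalCost≤0⇒w≡wL {p} {c} cost≤0 j pj≢c =
    p-q≡0⇒p≡q (p*q≡0⇒q≢0⇒p≡0 (w j - wL j) Q.∣ p j - c ∣ (term≡0 j)
                               (pj≢c ∘ p-q≡0⇒p≡q ∘ ∣p∣≡0⇒p≡0 (p j - c)))
    where
    term≡0 : ∀ j → (w j - wL j) * Q.∣ p j - c ∣ ≡ 0ℚ
    term≡0 = Σᶠ-nonNeg-≤0⇒≡0 (λ j → 0≤p⇒0≤q⇒0≤p*q (residual-nonNeg j) (0≤∣p∣ (p j - c))) cost≤0

module _ {m} {p : Fin (suc m) → ℚ} {ε S wS} (coreset : IsCoreset m p ε S wS) where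

  coreset-missing⇒weight≡m : Injective _≡_ _≡_ p → 0ℚ ≤ ε → ∀ i → wS i ≡ 0ℚ → Σᶠ wS ≡ ℕ→ℚ m
  coreset-missing⇒weight≡m p-inj 0≤ε i wSi≡0 with proj₂ (proj₂ coreset) (p i)
  ... | vX , vS , (_ , vX-min) , ((wL , wL∈𝓛 , cost≡vS) , _) , _ , vS≤ =
    trans (Σᶠ-cong wS≡wL) (proj₂ wL∈𝓛)
    where
    vX≤0 : vX ≤ 0ℚ
    vX≤0 = ≤-trans (vX-min _ (discardAllBut∈𝓛 i)) (≤-reflexive (removalCost-discardAllBut p i))
    vS≤0 : vS ≤ 0ℚ
    vS≤0 = ≤-trans vS≤ (≤-trans (*-monoˡ-≤-nonNeg (1ℚ + ε) {{nonNegative 0≤1+ε}} vX≤0)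
                                (≤-reflexive (*-zeroʳ (1ℚ + ε))))
      where 0≤1+ε = ≤-trans 0≤ε (0≤p⇒q≤p+q 0≤1)
    wS≡wL : ∀ j → wS j ≡ wL j
    wS≡wL j with j ≟ i
    ... | yes refl = ≤-antisym (≤-trans (≤-reflexive wSi≡0) (proj₁ (proj₁ wL∈𝓛 i))) (proj₂ (proj₁ wL∈𝓛 i))
    ... | no j≢i = removalCost≤0⇒w≡wL {m = m} wL∈𝓛 {p} (≤-trans (≤-reflexive cost≡vS) vS≤0) j (j≢i ∘ p-inj)

  coreset-weight≡m⇒¬far-centre : Σᶠ wS ≡ ℕ→ℚ m → ε < 1ℚ → ∀ c → (∀ j → 1ℚ ≤ Q.∣ p j - c ∣) → ⊥
  coreset-weight≡m⇒¬far-centre ΣwS≡m ε<1 c 1≤dist with proj₂ (proj₂ coreset) c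
  ... | vX , vS , ((wLX , wLX∈𝓛 , costX≡vX) , _) , ((wLS , wLS∈𝓛 , costS≡vS) , _) , ≤vS , _ =
    <-irrefl (sym (trans (sym costS≡vS) (removalCost-noExcess {m = m} wLS∈𝓛 {p} {c} ΣwS≡m))) 0<vS
    where
    open ≤-Reasoning
    1≤vX : 1ℚ ≤ vX
    1≤vX = begin
      1ℚ                                  ≡⟨ solve 1 (λ x → con 1ℚ := (con 1ℚ :+ x) :- x) refl (ℕ→ℚ m) ⟩
      (1ℚ + ℕ→ℚ m) - ℕ→ℚ m                ≡⟨ cong (_- ℕ→ℚ m) (trans (sym (ℕ→ℚ-suc m)) (sym (Σᶠ-1 (suc m)))) ⟩
      Σᶠ {suc m} unit - ℕ→ℚ m             ≤⟨ removalCost-≥-excess {m = m} wLX∈𝓛 {p} {c} 1≤dist ⟩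
      removalCost p unit wLX c            ≡⟨ costX≡vX ⟩
      vX                                  ∎
      where open +-*-Solver
    0<vS : 0ℚ < vS
    0<vS = begin-strict
      0ℚ                <⟨ 0<1-ε ⟩
      (1ℚ - ε)          ≡⟨ sym (*-identityʳ (1ℚ - ε)) ⟩
      (1ℚ - ε) * 1ℚ     ≤⟨ *-monoˡ-≤-nonNeg (1ℚ - ε) {{nonNegative (<⇒≤ 0<1-ε)}} 1≤vX ⟩
      (1ℚ - ε) * vX     ≤⟨ ≤vS ⟩
      vS                ∎
      where 0<1-ε = p<q⇒0<q-p ε<1

  coreset-size : Injective _≡_ _≡_ p → 0ℚ ≤ ε → ε < 1ℚ → ∀ c → (∀ j → 1ℚ ≤ Q.∣ p j - c ∣) → ∣ S ∣ ≡ suc m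
  coreset-size p-inj 0≤ε ε<1 c 1≤dist = trans (cong ∣_∣ S≡⊤) (∣⊤∣≡n (suc m))
    where
    ∈S : ∀ i → i ∈ S
    ∈S i with i ∈? S
    ... | yes i∈S = i∈S
    ... | no  i∉S = ⊥-elim (coreset-weight≡m⇒¬far-centre
                      (coreset-missing⇒weight≡m p-inj 0≤ε i (proj₁ (proj₂ coreset) i i∉S)) ε<1 c 1≤dist)
    S≡⊤ : S ≡ ⊤
    S≡⊤ = ⊆-antisym ⊆⊤ (λ {i} _ → ∈S i)

naturals : ∀ {n} → Fin n → ℚ
naturals = ℕ→ℚ ∘ toℕ

naturals-injective : ∀ {n} → Injective _≡_ _≡_ (naturals {n})
naturals-injective = toℕ-injective ∘ ℕ→ℚ-injective

1≤∣naturals-[-1]∣ : ∀ {n} (j : Fin n) → 1ℚ ≤ Q.∣ naturals j - - 1ℚ ∣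
1≤∣naturals-[-1]∣ j = begin
  1ℚ                       ≤⟨ 0≤q⇒p≤p+q (0≤ℕ→ℚ k) ⟩
  1ℚ + ℕ→ℚ k               ≡⟨ sym (0≤p⇒∣p∣≡p (≤-trans 0≤1 (0≤q⇒p≤p+q (0≤ℕ→ℚ k)))) ⟩
  Q.∣ 1ℚ + ℕ→ℚ k ∣         ≡⟨ cong Q.∣_∣ (solve 1 (λ x → con 1ℚ :+ x := x :- (:- con 1ℚ)) refl (ℕ→ℚ k)) ⟩
  Q.∣ ℕ→ℚ k - - 1ℚ ∣       ∎
  where
  k = toℕ j
  open ≤-Reasoning
  open +-*-Solver

theorem4p1 : Σ ℚ λ κ → (0ℚ < κ) × ((m : ℕ) → m ≥ 1 →
    Σ ℕ λ n → (n ≥ m) × Σ (Fin n → ℚ) λ p → Injective _≡_ _≡_ p ×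
      ((ε : ℚ) → 0ℚ < ε → ε < ½ → (S : Subset n) → (wS : Fin n → ℚ) →
        IsCoreset m p ε S wS → κ * ℕ→ℚ m ≤ ℕ→ℚ ∣ S ∣))
theorem4p1 = 1ℚ , from-yes (0ℚ <? 1ℚ) , λ m _ →
  suc m , n≤1+n m , naturals , naturals-injective , λ ε 0<ε ε<½ S wS coreset →
    let ∣S∣≡1+m = coreset-size coreset naturals-injective (<⇒≤ 0<ε) (<-trans ε<½ ½<1) (- 1ℚ) 1≤∣naturals-[-1]∣
    in begin
      1ℚ * ℕ→ℚ m       ≡⟨ *-identityˡ (ℕ→ℚ m) ⟩
      ℕ→ℚ m            ≤⟨ 0≤p⇒q≤p+q 0≤1 ⟩
      1ℚ + ℕ→ℚ m       ≡⟨ sym (ℕ→ℚ-suc m) ⟩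
      ℕ→ℚ (suc m)      ≡⟨ cong ℕ→ℚ (sym ∣S∣≡1+m) ⟩
      ℕ→ℚ ∣ S ∣        ∎
  where
  open ≤-Reasoning
  ½<1 : ½ < 1ℚ
  ½<1 = from-yes (½ <? 1ℚ)
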